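{- Let $G$ be a connected graph on $n$ vertices, and let $I\subseteq V(G)$. Suppose that for every $x\in V(G)$ there exists a nonnegative integer $r=r_x$ such that for every $S\subseteq B(x,r)$ the inequality $|I\cap N(S,r+1)|\geq |S|$ holds. Then $|I|\geq c(G)$.
   Context: Cops and robbers game on a finite connected undirected graph $G$: there are $m$ cops and one robber. First each cop chooses a vertex, then the robber chooses a vertex. They then move alternately, cops first; in the cops' turn each cop may move to an adjacent vertex or stay, and likewise for the robber in his turn. The cops win if some cop lands on the robber's vertex. The cop number $c(G)$ is the minimal $m$ such that $m$ cops have a winning strategy. For $x\in V(G)$ and an integer $r\ge 0$, $B(x,r)$ is the set of vertices at graph distance at most $r$ from $x$. For $S\subseteq V(G)$, $N(S,r)$ is the set of vertices at distance at most $r$ from $S$. -}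

module Defs where

open import Data.Nat using (ℕ; zero; suc)
open import Data.Bool using (Bool; true; false; _∧_; _∨_)
open import Data.Fin using (Fin)
open import Data.Fin.Subset using (Subset)
open import Data.Fin.Properties using (any?; _≟_)
open import Data.Vec using (tabulate; lookup)
open import Data.Product using (Σ; ∃; _×_; _,_)
open import Data.Sum using (_⊎_)
open import Relation.Nullary using (does)
open import Relation.Binary.PropositionalEquality using (_≡_)

record Graph (n : ℕ) : Set where
  field
    adj     : Fin n → Fin n → Bool
    adj-sym : ∀ x y → adj x y ≡ adj y x
    adj-irr : ∀ x → adj x x ≡ false
open Graph public

anyFin : ∀ {n} → (Fin n → Bool) → Bool
anyFin p = does (any? (λ z → p z Data.Bool.≟ true))

-- within G r x y = true  iff  dist_G(x , y) ≤ r
-- (there is a walk of length at most r from x to y).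
within : ∀ {n} → Graph n → ℕ → Fin n → Fin n → Bool
within G zero    x y = does (x ≟ y)
within G (suc r) x y = within G r x y ∨ anyFin (λ z → within G r x z ∧ adj G z y)

Connected : ∀ {n} → Graph n → Set
Connected {n} G = (x y : Fin n) → ∃ λ r → within G r x y ≡ true

Ball : ∀ {n} → Graph n → Fin n → ℕ → Subset n
Ball G x r = tabulate (λ y → within G r x y)

Nbhd : ∀ {n} → Graph n → Subset n → ℕ → Subset n
Nbhd G S r = tabulate (λ y → anyFin (λ s → lookup S s ∧ within G r s y))

Step : ∀ {n} → Graph n → Fin n → Fin n → Set
Step G x y = (y ≡ x) ⊎ (adj G x y ≡ true)

Caught : ∀ {n m} → (Fin m → Fin n) → Fin n → Set
Caught {m = m} c r = Σ (Fin m) λ i → c i ≡ r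

-- Positions from which the cops can force capture in finitely many rounds.
-- CopsToMove c r : cops at c, robber at r, cops to move.
-- RobberToMove c r : cops at c, robber at r, robber to move.
mutual
  data CopsToMove {n m : ℕ} (G : Graph n) : (Fin m → Fin n) → Fin n → Set where
    cops-move : ∀ {c r} (c′ : Fin m → Fin n) →
                (∀ i → Step G (c i) (c′ i)) →
                Caught c′ r ⊎ RobberToMove G c′ r →
                CopsToMove G c r

  data RobberToMove {n m : ℕ} (G : Graph n) : (Fin m → Fin n) → Fin n → Set where
    robber-move : ∀ {c r} →
                  (∀ r′ → Step G r r′ → Caught c r′ ⊎ CopsToMove G c r′) →
                  RobberToMove G c r

CopsWin : ∀ {n} → Graph n → ℕ → Set
CopsWin {n} G m = Σ (Fin m → Fin n) λ c → (r : Fin n) → Caught c r ⊎ CopsToMove G c r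

module Submission where

-- Put one cop on every vertex of I.  When the robber appears at x, Hall's
-- theorem turns the hypothesis at x into an injection from B(x, r) into I
-- matching every vertex of the ball with a cop at distance at most r + 1.
-- Each matched cop walks to its vertex in r + 1 moves.  After r moves of
-- his own the robber is still in B(x, r), so the (r + 1)-st move of the cops
-- lands one of them on him.

open import Defs
open import Data.Nat using (ℕ; zero; suc; _+_; _≤_; _<_; z≤n; _≤?_; _<?_)
open import Data.Nat.Properties
open import Data.Bool using (Bool; true; false; _∧_; _∨_)
open import Data.Empty using (⊥-elim)
open import Data.Fin using (Fin; zero; suc)
open import Data.Fin.Subset
open import Data.Fin.Subset.Properties
open import Data.Fin.Properties using (any?) renaming (_≟_ to _≟F_)
open import Data.Vec using ([]; _∷_; lookup; tabulate; here; there)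
open import Data.Vec.Properties using (lookup∘tabulate; []=⇒lookup; lookup⇒[]=)
open import Data.Product using (Σ; ∃; _×_; _,_; proj₁; proj₂)
open import Data.Sum using (_⊎_; inj₁; inj₂)
open import Relation.Nullary using (Dec; yes; no; does)
open import Relation.Nullary.Decidable using (dec-true; _×-dec_)
open import Relation.Binary.PropositionalEquality

∧-true⁺ : ∀ {a b} → a ≡ true → b ≡ true → a ∧ b ≡ true
∧-true⁺ refl refl = refl

∧-true⁻ : ∀ {a b} → a ∧ b ≡ true → a ≡ true × b ≡ true
∧-true⁻ {true} {true} refl = refl , refl

∨-true⁺ˡ : ∀ {a b} → a ≡ true → a ∨ b ≡ true
∨-true⁺ˡ refl = refl

∨-true⁺ʳ : ∀ {a b} → b ≡ true → a ∨ b ≡ true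
∨-true⁺ʳ {true} refl = refl
∨-true⁺ʳ {false} refl = refl

∨-true⁻ : ∀ {a b} → a ∨ b ≡ true → a ≡ true ⊎ b ≡ true
∨-true⁻ {true} refl = inj₁ refl
∨-true⁻ {false} h = inj₂ h

does-true⇒ : ∀ {a} {A : Set a} (a? : Dec A) → does a? ≡ true → A
does-true⇒ (yes a) _ = a

anyFin⁺ : ∀ {n} (p : Fin n → Bool) z → p z ≡ true → anyFin p ≡ true
anyFin⁺ p z pz = dec-true (any? λ z → p z Data.Bool.≟ true) (z , pz)

anyFin⁻ : ∀ {n} (p : Fin n → Bool) → anyFin p ≡ true → ∃ λ z → p z ≡ true
anyFin⁻ p = does-true⇒ (any? λ z → p z Data.Bool.≟ true)

x∈tabulate⁺ : ∀ {n} {x : Fin n} (f : Fin n → Bool) → f x ≡ true → x ∈ tabulate f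
x∈tabulate⁺ {x = x} f fx = lookup⇒[]= x (tabulate f) (trans (lookup∘tabulate f x) fx)

x∈tabulate⁻ : ∀ {n} {x : Fin n} (f : Fin n → Bool) → x ∈ tabulate f → f x ≡ true
x∈tabulate⁻ {x = x} f x∈ = trans (sym (lookup∘tabulate f x)) ([]=⇒lookup x∈)

x∈p─q⇒x∉q : ∀ {n} {x : Fin n} (p q : Subset n) → x ∈ p ─ q → x ∉ q
x∈p─q⇒x∉q (_ ∷ p) (true ∷ q) () here
x∈p─q⇒x∉q (_ ∷ p) (_ ∷ q) (there x∈) (there x∈q) = x∈p─q⇒x∉q p q x∈ x∈q

∣p∪q∣+∣p∩q∣≡∣p∣+∣q∣ : ∀ {n} (p q : Subset n) → ∣ p ∪ q ∣ + ∣ p ∩ q ∣ ≡ ∣ p ∣ + ∣ q ∣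
∣p∪q∣+∣p∩q∣≡∣p∣+∣q∣ [] [] = refl
∣p∪q∣+∣p∩q∣≡∣p∣+∣q∣ (true ∷ p) (true ∷ q) = cong suc (begin
  ∣ p ∪ q ∣ + suc ∣ p ∩ q ∣  ≡⟨ +-suc _ _ ⟩
  suc (∣ p ∪ q ∣ + ∣ p ∩ q ∣) ≡⟨ cong suc (∣p∪q∣+∣p∩q∣≡∣p∣+∣q∣ p q) ⟩
  suc (∣ p ∣ + ∣ q ∣)         ≡⟨ +-suc _ _ ⟨
  ∣ p ∣ + suc ∣ q ∣           ∎)
  where open ≡-Reasoning
∣p∪q∣+∣p∩q∣≡∣p∣+∣q∣ (true ∷ p) (false ∷ q) = cong suc (∣p∪q∣+∣p∩q∣≡∣p∣+∣q∣ p q)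
∣p∪q∣+∣p∩q∣≡∣p∣+∣q∣ (false ∷ p) (true ∷ q) =
  trans (cong suc (∣p∪q∣+∣p∩q∣≡∣p∣+∣q∣ p q)) (sym (+-suc _ _))
∣p∪q∣+∣p∩q∣≡∣p∣+∣q∣ (false ∷ p) (false ∷ q) = ∣p∪q∣+∣p∩q∣≡∣p∣+∣q∣ p q

∣p∪q∣≤∣p∣+∣q∣ : ∀ {n} (p q : Subset n) → ∣ p ∪ q ∣ ≤ ∣ p ∣ + ∣ q ∣
∣p∪q∣≤∣p∣+∣q∣ p q = subst (∣ p ∪ q ∣ ≤_) (∣p∪q∣+∣p∩q∣≡∣p∣+∣q∣ p q) (m≤m+n _ _)

Empty⇒∣p∣≡0 : ∀ {n} {p : Subset n} → Empty p → ∣ p ∣ ≡ 0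
Empty⇒∣p∣≡0 {n} p-empty rewrite Empty-unique p-empty = ∣⊥∣≡0 n

disjoint⇒∣p∣+∣q∣≡∣p∪q∣ : ∀ {n} (p q : Subset n) → (∀ {x} → x ∈ p → x ∉ q) →
                         ∣ p ∣ + ∣ q ∣ ≡ ∣ p ∪ q ∣
disjoint⇒∣p∣+∣q∣≡∣p∪q∣ p q disjoint = begin
  ∣ p ∣ + ∣ q ∣              ≡⟨ ∣p∪q∣+∣p∩q∣≡∣p∣+∣q∣ p q ⟨
  ∣ p ∪ q ∣ + ∣ p ∩ q ∣      ≡⟨ cong (∣ p ∪ q ∣ +_) (Empty⇒∣p∣≡0 p∩q-empty) ⟩
  ∣ p ∪ q ∣ + 0              ≡⟨ +-identityʳ _ ⟩
  ∣ p ∪ q ∣                  ∎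
  where
  open ≡-Reasoning
  p∩q-empty : Empty (p ∩ q)
  p∩q-empty (x , x∈p∩q) = let (x∈p , x∈q) = x∈p∩q⁻ p q x∈p∩q in disjoint x∈p x∈q

0<∣p∣⇒Nonempty : ∀ {n} (p : Subset n) → 0 < ∣ p ∣ → Nonempty p
0<∣p∣⇒Nonempty p 0<∣p∣ with nonempty? p
... | yes p-nonempty = p-nonempty
... | no p-empty = ⊥-elim (<-irrefl (sym (Empty⇒∣p∣≡0 p-empty)) 0<∣p∣)

∣p∩q∣≤∣[p-x]∩q∣+1 : ∀ {n} (p q : Subset n) x → ∣ p ∩ q ∣ ≤ ∣ (p - x) ∩ q ∣ + 1
∣p∩q∣≤∣[p-x]∩q∣+1 p q x = begin
  ∣ p ∩ q ∣                    ≤⟨ p⊆q⇒∣p∣≤∣q∣ split ⟩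
  ∣ (p - x) ∩ q ∪ ⁅ x ⁆ ∣      ≤⟨ ∣p∪q∣≤∣p∣+∣q∣ ((p - x) ∩ q) ⁅ x ⁆ ⟩
  ∣ (p - x) ∩ q ∣ + ∣ ⁅ x ⁆ ∣  ≡⟨ cong (∣ (p - x) ∩ q ∣ +_) (∣⁅x⁆∣≡1 x) ⟩
  ∣ (p - x) ∩ q ∣ + 1          ∎
  where
  open ≤-Reasoning
  split : p ∩ q ⊆ (p - x) ∩ q ∪ ⁅ x ⁆
  split {y} y∈p∩q with y ≟F x
  ... | yes refl = x∈p∪q⁺ (inj₂ (x∈⁅x⁆ x))
  ... | no y≢x   = let (y∈p , y∈q) = x∈p∩q⁻ p q y∈p∩q in
    x∈p∪q⁺ (inj₁ (x∈p∩q⁺ (x∈p∧x≢y⇒x∈p-y y∈p y≢x , y∈q)))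

enumerate : ∀ {n} (p : Subset n) → Fin ∣ p ∣ → Fin n
enumerate (true ∷ p) zero = zero
enumerate (true ∷ p) (suc i) = suc (enumerate p i)
enumerate (false ∷ p) i = suc (enumerate p i)

enumerate-surjective : ∀ {n} (p : Subset n) {x} → x ∈ p → ∃ λ i → enumerate p i ≡ x
enumerate-surjective (true ∷ p) here = zero , refl
enumerate-surjective (true ∷ p) (there x∈p) =
  let (i , eq) = enumerate-surjective p x∈p in suc i , cong suc eq
enumerate-surjective (false ∷ p) (there x∈p) =
  let (i , eq) = enumerate-surjective p x∈p in i , cong suc eq

module Hall {n : ℕ} (R : Fin n → Fin n → Bool) where

  N : Subset n → Subset n
  N S = tabulate (λ y → anyFin (λ s → lookup S s ∧ R s y))

  ∈N⁺ : ∀ {S s y} → s ∈ S → R s y ≡ true → y ∈ N S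
  ∈N⁺ {S} {s} {y} s∈S Rsy = x∈tabulate⁺ (λ y → anyFin (λ s → lookup S s ∧ R s y))
    (anyFin⁺ (λ s → lookup S s ∧ R s y) s (∧-true⁺ ([]=⇒lookup s∈S) Rsy))

  ∈N⁻ : ∀ {S y} → y ∈ N S → ∃ λ s → s ∈ S × R s y ≡ true
  ∈N⁻ {S} {y} y∈NS =
    let (s , h) = anyFin⁻ (λ s → lookup S s ∧ R s y)
                    (x∈tabulate⁻ (λ y → anyFin (λ s → lookup S s ∧ R s y)) y∈NS)
        (s∈S , Rsy) = ∧-true⁻ h
    in s , lookup⇒[]= s S s∈S , Rsy

  record Matching (L I : Subset n) : Set where
    field
      match           : Fin n → Fin n
      match-∈         : ∀ {v} → v ∈ L → match v ∈ I
      match-R         : ∀ {v} → v ∈ L → R v (match v) ≡ true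
      match-injective : ∀ {v w} → v ∈ L → w ∈ L → match v ≡ match w → v ≡ w
  open Matching

  HallCondition : Subset n → Subset n → Set
  HallCondition L I = ∀ S → S ⊆ L → ∣ S ∣ ≤ ∣ I ∩ N S ∣

  Critical : Subset n → Subset n → Subset n → Set
  Critical L I S = S ⊆ L × Nonempty S × ∣ S ∣ < ∣ L ∣ × ∣ I ∩ N S ∣ ≤ ∣ S ∣

  critical? : ∀ L I S → Dec (Critical L I S)
  critical? L I S =
    (S ⊆? L) ×-dec nonempty? S ×-dec (∣ S ∣ <? ∣ L ∣) ×-dec (∣ I ∩ N S ∣ ≤? ∣ S ∣)

  empty-matching : ∀ {L} I → Empty L → Matching L I
  empty-matching I L-empty = record
    { match           = λ v → v
    ; match-∈         = λ v∈L → ⊥-elim (L-empty (_ , v∈L))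
    ; match-R         = λ v∈L → ⊥-elim (L-empty (_ , v∈L))
    ; match-injective = λ v∈L _ _ → ⊥-elim (L-empty (_ , v∈L))
    }

  singleton-matching : ∀ {I v u} → u ∈ I → R v u ≡ true → Matching ⁅ v ⁆ (I ∩ ⁅ u ⁆)
  singleton-matching {v = v} {u} u∈I Rvu = record
    { match           = λ _ → u
    ; match-∈         = λ _ → x∈p∩q⁺ (u∈I , x∈⁅x⁆ u)
    ; match-R         = λ w∈⁅v⁆ → subst (λ w → R w u ≡ true) (sym (x∈⁅y⁆⇒x≡y v w∈⁅v⁆)) Rvu
    ; match-injective = λ w∈⁅v⁆ w′∈⁅v⁆ _ → trans (x∈⁅y⁆⇒x≡y v w∈⁅v⁆) (sym (x∈⁅y⁆⇒x≡y v w′∈⁅v⁆))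
    }

  matching-into-N : ∀ {S I} → Matching S I → Matching S (I ∩ N S)
  matching-into-N M = record
    { match           = match M
    ; match-∈         = λ v∈S → x∈p∩q⁺ (match-∈ M v∈S , ∈N⁺ v∈S (match-R M v∈S))
    ; match-R         = match-R M
    ; match-injective = match-injective M
    }

  glue : ∀ {L I S J} → Matching S (I ∩ J) → Matching (L ─ S) (I ─ J) → Matching L I
  glue {L} {I} {S} {J} M₁ M₂ = record
    { match = f ; match-∈ = f-∈ ; match-R = f-R ; match-injective = f-injective }
    where
    choose : ∀ v → Dec (v ∈ S) → Fin n
    choose v (yes _) = match M₁ v
    choose v (no _)  = match M₂ v

    f : Fin n → Fin n
    f v = choose v (v ∈? S)

    f-∈ : ∀ {v} → v ∈ L → f v ∈ I
    f-∈ {v} v∈L with v ∈? S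
    ... | yes v∈S = p∩q⊆p I J (match-∈ M₁ v∈S)
    ... | no v∉S  = p─q⊆p I J (match-∈ M₂ (x∈p∧x∉q⇒x∈p─q v∈L v∉S))

    f-R : ∀ {v} → v ∈ L → R v (f v) ≡ true
    f-R {v} v∈L with v ∈? S
    ... | yes v∈S = match-R M₁ v∈S
    ... | no v∉S  = match-R M₂ (x∈p∧x∉q⇒x∈p─q v∈L v∉S)

    separated : ∀ {v w} → v ∈ S → w ∈ L ─ S → match M₁ v ≢ match M₂ w
    separated v∈S w∈L─S eq = x∈p─q⇒x∉q I J (match-∈ M₂ w∈L─S)
      (subst (_∈ J) eq (p∩q⊆q I J (match-∈ M₁ v∈S)))

    f-injective : ∀ {v w} → v ∈ L → w ∈ L → f v ≡ f w → v ≡ w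
    f-injective {v} {w} v∈L w∈L eq with v ∈? S | w ∈? S
    ... | yes v∈S | yes w∈S = match-injective M₁ v∈S w∈S eq
    ... | no v∉S  | no w∉S  =
      match-injective M₂ (x∈p∧x∉q⇒x∈p─q v∈L v∉S) (x∈p∧x∉q⇒x∈p─q w∈L w∉S) eq
    ... | yes v∈S | no w∉S  = ⊥-elim (separated v∈S (x∈p∧x∉q⇒x∈p─q w∈L w∉S) eq)
    ... | no v∉S  | yes w∈S = ⊥-elim (separated w∈S (x∈p∧x∉q⇒x∈p─q v∈L v∉S) (sym eq))

  N-∪-split : ∀ (I T S : Subset n) → I ∩ N (T ∪ S) ⊆ (I ─ N S) ∩ N T ∪ I ∩ N S
  N-∪-split I T S {y} y∈ with x∈p∩q⁻ I (N (T ∪ S)) y∈ | y ∈? N S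
  ... | y∈I , _      | yes y∈NS = x∈p∪q⁺ (inj₂ (x∈p∩q⁺ (y∈I , y∈NS)))
  ... | y∈I , y∈NT∪S | no y∉NS with ∈N⁻ y∈NT∪S
  ...   | s , s∈T∪S , Rsy with x∈p∪q⁻ T S s∈T∪S
  ...     | inj₁ s∈T = x∈p∪q⁺ (inj₁ (x∈p∩q⁺ (x∈p∧x∉q⇒x∈p─q y∈I y∉NS , ∈N⁺ s∈T Rsy)))
  ...     | inj₂ s∈S = ⊥-elim (y∉NS (∈N⁺ s∈S Rsy))

  hallCondition-─-critical : ∀ {L I S} → HallCondition L I → S ⊆ L → ∣ I ∩ N S ∣ ≤ ∣ S ∣ →
                             HallCondition (L ─ S) (I ─ N S)
  hallCondition-─-critical {L} {I} {S} hc S⊆L tight T T⊆L─S =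
    +-cancelʳ-≤ (∣ S ∣) (∣ T ∣) (∣ (I ─ N S) ∩ N T ∣) (begin
      ∣ T ∣ + ∣ S ∣                              ≡⟨ disjoint⇒∣p∣+∣q∣≡∣p∪q∣ T S T∩S-empty ⟩
      ∣ T ∪ S ∣                                  ≤⟨ hc (T ∪ S) T∪S⊆L ⟩
      ∣ I ∩ N (T ∪ S) ∣                          ≤⟨ p⊆q⇒∣p∣≤∣q∣ (N-∪-split I T S) ⟩
      ∣ (I ─ N S) ∩ N T ∪ I ∩ N S ∣              ≤⟨ ∣p∪q∣≤∣p∣+∣q∣ ((I ─ N S) ∩ N T) (I ∩ N S) ⟩
      ∣ (I ─ N S) ∩ N T ∣ + ∣ I ∩ N S ∣          ≤⟨ +-monoʳ-≤ (∣ (I ─ N S) ∩ N T ∣) tight ⟩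
      ∣ (I ─ N S) ∩ N T ∣ + ∣ S ∣                ∎)
    where
    open ≤-Reasoning
    T∩S-empty : ∀ {x} → x ∈ T → x ∉ S
    T∩S-empty x∈T = x∈p─q⇒x∉q L S (T⊆L─S x∈T)
    T∪S⊆L : T ∪ S ⊆ L
    T∪S⊆L x∈T∪S with x∈p∪q⁻ T S x∈T∪S
    ... | inj₁ x∈T = p─q⊆p L S (T⊆L─S x∈T)
    ... | inj₂ x∈S = S⊆L x∈S

  hallCondition-remove : ∀ {L I v} u → v ∈ L →
    (∀ S → S ⊆ L → Nonempty S → ∣ S ∣ < ∣ L ∣ → ∣ S ∣ < ∣ I ∩ N S ∣) →
    HallCondition (L - v) (I - u)
  hallCondition-remove {L} {I} {v} u v∈L surplus S S⊆L-v with nonempty? S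
  ... | no S-empty = subst (_≤ ∣ (I - u) ∩ N S ∣) (sym (Empty⇒∣p∣≡0 S-empty)) z≤n
  ... | yes S-nonempty = ≤-pred (begin
    suc ∣ S ∣              ≤⟨ surplus S (⊆-trans S⊆L-v (p─q⊆p L ⁅ v ⁆)) S-nonempty ∣S∣<∣L∣ ⟩
    ∣ I ∩ N S ∣            ≤⟨ ∣p∩q∣≤∣[p-x]∩q∣+1 I (N S) u ⟩
    ∣ (I - u) ∩ N S ∣ + 1  ≡⟨ +-comm _ 1 ⟩
    suc ∣ (I - u) ∩ N S ∣  ∎)
    where
    open ≤-Reasoning
    ∣S∣<∣L∣ : ∣ S ∣ < ∣ L ∣
    ∣S∣<∣L∣ = ≤-<-trans (p⊆q⇒∣p∣≤∣q∣ S⊆L-v) (x∈p⇒∣p-x∣<∣p∣ v∈L)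

  hallCondition⇒neighbour : ∀ {L I v} → HallCondition L I → v ∈ L → ∃ λ u → u ∈ I × R v u ≡ true
  hallCondition⇒neighbour {L} {I} {v} hc v∈L =
    let (u , u∈I∩N⁅v⁆) = 0<∣p∣⇒Nonempty (I ∩ N ⁅ v ⁆) 0<∣I∩N⁅v⁆∣
        (u∈I , u∈N⁅v⁆) = x∈p∩q⁻ I (N ⁅ v ⁆) u∈I∩N⁅v⁆
        (s , s∈⁅v⁆ , Rsu) = ∈N⁻ u∈N⁅v⁆
    in u , u∈I , subst (λ s → R s u ≡ true) (x∈⁅y⁆⇒x≡y v s∈⁅v⁆) Rsu
    where
    0<∣I∩N⁅v⁆∣ : 0 < ∣ I ∩ N ⁅ v ⁆ ∣
    0<∣I∩N⁅v⁆∣ = subst (_≤ ∣ I ∩ N ⁅ v ⁆ ∣) (∣⁅x⁆∣≡1 v)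
                   (hc ⁅ v ⁆ λ w∈⁅v⁆ → subst (_∈ L) (sym (x∈⁅y⁆⇒x≡y v w∈⁅v⁆)) v∈L)

  -- Halmos–Vaughan induction on |L|: a critical S splits the problem into
  -- matching S into I ∩ N S and L ─ S into I ─ N S; without one, every
  -- nonempty proper subset has a surplus, so any v can take any neighbour u.
  hall : ∀ k {L I} → ∣ L ∣ ≤ k → HallCondition L I → Matching L I
  hall zero {L} {I} ∣L∣≤0 _ =
    empty-matching I λ (v , v∈L) → <⇒≱ (≤-<-trans z≤n (x∈p⇒∣p-x∣<∣p∣ v∈L)) ∣L∣≤0
  hall (suc k) {L} {I} ∣L∣≤1+k hc with anySubset? (critical? L I)
  ... | yes (S , S⊆L , (s , s∈S) , ∣S∣<∣L∣ , tight) =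
    glue (matching-into-N (hall k {S} {I} (shrink S ∣S∣<∣L∣) (λ T T⊆S → hc T (⊆-trans T⊆S S⊆L))))
         (hall k {L ─ S} {I ─ N S} (shrink (L ─ S) ∣L─S∣<∣L∣)
                 (hallCondition-─-critical {I = I} hc S⊆L tight))
    where
    shrink : ∀ T → ∣ T ∣ < ∣ L ∣ → ∣ T ∣ ≤ k
    shrink T ∣T∣<∣L∣ = ≤-pred (≤-trans ∣T∣<∣L∣ ∣L∣≤1+k)
    ∣L─S∣<∣L∣ : ∣ L ─ S ∣ < ∣ L ∣
    ∣L─S∣<∣L∣ = p∩q≢∅⇒∣p─q∣<∣p∣ L S (s , x∈p∩q⁺ (S⊆L s∈S , s∈S))
  ... | no no-critical with nonempty? L
  ...   | no L-empty = empty-matching I L-empty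
  ...   | yes (v , v∈L) =
    let (u , u∈I , Rvu) = hallCondition⇒neighbour hc v∈L in
    glue (singleton-matching u∈I Rvu)
         (hall k {L - v} {I - u} (≤-pred (≤-trans (x∈p⇒∣p-x∣<∣p∣ v∈L) ∣L∣≤1+k))
                 (hallCondition-remove {I = I} u v∈L surplus))
    where
    surplus : ∀ S → S ⊆ L → Nonempty S → ∣ S ∣ < ∣ L ∣ → ∣ S ∣ < ∣ I ∩ N S ∣
    surplus S S⊆L S-nonempty ∣S∣<∣L∣ =
      ≰⇒> λ tight → no-critical (S , S⊆L , S-nonempty , ∣S∣<∣L∣ , tight)

  hallCondition⇒matching : ∀ {L I} → HallCondition L I → Matching L I
  hallCondition⇒matching = hall _ ≤-refl

within-zero-refl : ∀ {n} (G : Graph n) x → within G 0 x x ≡ true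
within-zero-refl G x = dec-true (x ≟F x) refl

within-step : ∀ {n} (G : Graph n) {t x y y′} → within G t x y ≡ true → Step G y y′ →
              within G (suc t) x y′ ≡ true
within-step G x~y (inj₁ refl) = ∨-true⁺ˡ x~y
within-step G {t} {x} {y} {y′} x~y (inj₂ y-y′) =
  ∨-true⁺ʳ (anyFin⁺ (λ z → within G t x z ∧ adj G z y′) y (∧-true⁺ x~y y-y′))

-- Walks are infinite sequences of steps, so that walks of different lengths
-- can serve as trajectories in the same play; only position k is pinned.
record Walk {n} (G : Graph n) (k : ℕ) (a b : Fin n) : Set where
  field
    position : ℕ → Fin n
    starts   : position 0 ≡ a
    steps    : ∀ j → Step G (position j) (position (suc j))
    ends     : position k ≡ b
open Walk

walk-stay : ∀ {n} {G : Graph n} k a → Walk G k a a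
walk-stay k a = record
  { position = λ _ → a ; starts = refl ; steps = λ _ → inj₁ refl ; ends = refl }

walk-∷ : ∀ {n} {G : Graph n} {k a b c} → Step G a b → Walk G k b c → Walk G (suc k) a c
walk-∷ {n} {G} {a = a} a-b W = record
  { position = position′ ; starts = refl ; steps = steps′ ; ends = ends W }
  where
  position′ : ℕ → Fin n
  position′ zero    = a
  position′ (suc j) = position W j
  steps′ : ∀ j → Step G (position′ j) (position′ (suc j))
  steps′ zero    = subst (Step G a) (sym (starts W)) a-b
  steps′ (suc j) = steps W j

within⇒walk : ∀ {n} (G : Graph n) k {x y} → within G k x y ≡ true → Walk G k y x
within⇒walk G zero {x} {y} x~y = subst (Walk G 0 y) (sym (does-true⇒ (x ≟F y) x~y)) (walk-stay 0 y)
within⇒walk G (suc k) {x} {y} x~y with ∨-true⁻ x~y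
... | inj₁ x~ₖy = walk-∷ (inj₁ refl) (within⇒walk G k x~ₖy)
... | inj₂ x~z-y =
  let (z , x~z∧z-y) = anyFin⁻ (λ z → within G k x z ∧ adj G z y) x~z-y
      (x~z , z-y) = ∧-true⁻ x~z∧z-y
  in walk-∷ (inj₂ (trans (adj-sym G y z) z-y)) (within⇒walk G k x~z)

catch-in-ball : ∀ {n m} (G : Graph n) (C : ℕ → Fin m → Fin n) →
                (∀ t i → Step G (C t i) (C (suc t) i)) → ∀ x r →
                (∀ {y} → y ∈ Ball G x r → Caught (C (suc r)) y) → CopsToMove G (C 0) x
catch-in-ball G C moves x r covers = chase r 0 x (+-identityʳ r) (within-zero-refl G x)
  where
  -- d rounds remain, and after t moves the robber is still in B(x, t).
  chase : ∀ d t y → d + t ≡ r → within G t x y ≡ true → CopsToMove G (C t) y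
  chase zero t y refl x~y =
    cops-move (C (suc t)) (moves t) (inj₁ (covers (x∈tabulate⁺ (within G t x) x~y)))
  chase (suc d) t y d+t≡r x~y = cops-move (C (suc t)) (moves t) (inj₂ (robber-move λ y′ y-y′ →
    inj₂ (chase d (suc t) y′ (trans (+-suc d t) d+t≡r) (within-step G {t} {x} x~y y-y′))))

module Pursuit {n m} (G : Graph n) (k : ℕ) (cops : Fin m → Fin n) {L : Subset n}
  (f : Fin n → Fin n)
  (f-within : ∀ {y} → y ∈ L → within G k y (f y) ≡ true)
  (f-injective : ∀ {y z} → y ∈ L → z ∈ L → f y ≡ f z → y ≡ z)
  where

  record Route (i : Fin m) : Set where
    field
      target    : Fin n
      walk      : Walk G k (cops i) target
      target-matched : ∀ {y} → y ∈ L → f y ≡ cops i → target ≡ y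
  open Route

  route : ∀ i → Route i
  route i with any? (λ y → (y ∈? L) ×-dec (f y ≟F cops i))
  ... | yes (y , y∈L , fy≡ci) = record
    { target    = y
    ; walk      = within⇒walk G k (subst (λ c → within G k y c ≡ true) fy≡ci (f-within y∈L))
    ; target-matched = λ z∈L fz≡ci → f-injective y∈L z∈L (trans fy≡ci (sym fz≡ci))
    }
  ... | no unmatched = record
    { target    = cops i
    ; walk      = walk-stay k (cops i)
    ; target-matched = λ y∈L fy≡ci → ⊥-elim (unmatched (_ , y∈L , fy≡ci))
    }

  trajectory : ℕ → Fin m → Fin n
  trajectory zero      = cops
  trajectory (suc t) i = position (walk (route i)) (suc t)

  trajectory≡position : ∀ t i → trajectory t i ≡ position (walk (route i)) t
  trajectory≡position zero    i = sym (starts (walk (route i)))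
  trajectory≡position (suc t) i = refl

  trajectory-steps : ∀ t i → Step G (trajectory t i) (trajectory (suc t) i)
  trajectory-steps t i =
    subst (λ c → Step G c (trajectory (suc t) i)) (sym (trajectory≡position t i))
          (steps (walk (route i)) t)

  trajectory-covers : ∀ {y} → y ∈ L → (∃ λ i → cops i ≡ f y) → Caught (trajectory k) y
  trajectory-covers {y} y∈L (i , ci≡fy) = i , (begin
    trajectory k i                ≡⟨ trajectory≡position k i ⟩
    position (walk (route i)) k   ≡⟨ ends (walk (route i)) ⟩
    target (route i)              ≡⟨ target-matched (route i) y∈L (sym ci≡fy) ⟩
    y                             ∎)
    where open ≡-Reasoning

mainTheorem2 : (n : ℕ) → 0 < n → (G : Graph n) → Connected G → (I : Subset n) →
    ((x : Fin n) → ∃ λ r → (S : Subset n) → S ⊆ Ball G x r →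
        ∣ S ∣ ≤ ∣ I ∩ Nbhd G S (suc r) ∣) →
    Σ ℕ λ m → m ≤ ∣ I ∣ × CopsWin G m
mainTheorem2 n _ G _ I hall-at = ∣ I ∣ , ≤-refl , enumerate I , λ x → inj₂ (catch x)
  where
  catch : ∀ x → CopsToMove G (enumerate I) x
  catch x = catch-in-ball G trajectory trajectory-steps x r λ y∈B →
    trajectory-covers y∈B (enumerate-surjective I (match-∈ y∈B))
    where
    r : ℕ
    r = proj₁ (hall-at x)
    open Hall (within G (suc r))
    M : Matching (Ball G x r) I
    -- Here N S is Nbhd G S (suc r) by definition.
    M = hallCondition⇒matching (proj₂ (hall-at x))
    open Matching M
    open Pursuit G (suc r) (enumerate I) match match-R match-injective
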